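{- Let $\Gamma$ be a coloring and $\Omega$ a $k$-ordering of $T_{d,k}$ with initial $d$-cell $\mathcal T$. For every $-1\le j\le d$, let $\mathcal M^j=\{K_{\widehat J}\,g: g\in G_{d,k},\ J\subseteq[\![d]\!],\ |J|=j+1\}$. Then the map $\Psi_j:\mathcal M^j\to T^j_{d,k}$ given by $$\Psi_j(K_{\widehat J}\,g)=\text{the unique cell of } g.\mathcal T \text{ whose color is } J$$ is a well-defined bijection.
   Context: $[\![d]\!]=\{0,\dots,d\}$. $G_{d,k}=\langle\alpha_0,\dots,\alpha_d\mid\alpha_i^k=e\rangle$; for $J\subseteq[\![d]\!]$, $K_J=\langle\alpha_j:j\in J\rangle$ and $\widehat J=[\![d]\!]\setminus J$; $K_{\widehat J}g$ denotes a right coset. Arboreal complex $T_{d,k}$: $B_0$ is a single $d$-cell $\mathcal T$ with its faces; $B_{n+1}$ is obtained from $B_n$ by attaching to each $(d-1)$-cell of $B_n$ contained in exactly one $d$-cell of $B_n$ $k-1$ new $d$-cells, each with a new vertex; $T_{d,k}=\bigcup_nB_n$; $T^j_{d,k}$ is its set of $j$-cells (cells with $j+1$ vertices, $T^{ -1}_{d,k}=\{\emptyset\}$). A coloring $\Gamma:T^0_{d,k}\to[\![d]\!]$ is injective on each $d$-cell; the color of a cell $\rho$ is $\Gamma(\rho)=\{\Gamma(v):v\in\rho\}$. A $k$-ordering $\Omega$ assigns to each $(d-1)$-cell $\sigma$ a transitive homomorphism $\Omega_\sigma:C_k\to\mathcal S_{\delta(\sigma)}$, $\delta(\sigma)$ the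 set of $d$-cells containing $\sigma$, $C_k$ cyclic of order $k$. $G_{d,k}$ acts on the left on $d$-cells by $\alpha_i^l.\tau=\Omega_\sigma(\alpha_i^l).\tau$, $\sigma$ the $(d-1)$-cell of $\tau$ of color $[\![d]\!]\setminus\{i\}$ (identifying $C_k$ with $\langle\alpha_i\rangle$), extended to words (a well-defined action). -}

module Defs where

open import Level using (0ℓ)
open import Data.Nat using (ℕ; zero; suc; _+_; _∸_; _≤_; NonZero)
open import Data.Nat.DivMod using (_mod_)
open import Data.Fin using (Fin; toℕ; _≟_)
open import Data.Fin.Subset using (Subset; _∈_; ∁; ∣_∣) renaming (⊤ to full)
open import Data.Vec using (tabulate; lookup)
open import Data.List using (List; []; _∷_; _++_; replicate)
open import Data.List.Relation.Unary.All using (All)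
open import Data.Product using (Σ; _×_; _,_; ∃; proj₁)
open import Data.Unit using (⊤; tt)
open import Data.Bool using (not; if_then_else_)
open import Relation.Nullary using (does)
open import Relation.Binary.PropositionalEquality using (_≡_; _≢_)
open import Function.Bundles using (_⇔_)

module Arboreal (d k : ℕ) .{{nz : NonZero k}} where

  Col : Set
  Col = Fin (suc d)

  -- A d-cell is encoded by the sequence of
  -- attachments leading to it from the initial cell 𝒯 (most recent step first).
  -- A step (i , c) : the current cell's vertex in position i is replaced by a
  -- new vertex, i.e. we attach, along the facet omitting position i, the c-th
  -- of the k-1 new d-cells.
  Step : Set
  Step = Col × Fin (k ∸ 1)

  Path : Set
  Path = List Step

  -- A free facet of a non-initial d-cell is one containing its newest vertex,
  -- i.e. one omitting a position different from the last step's position.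
  Valid : Path → Set
  Valid [] = ⊤
  Valid (s ∷ []) = ⊤
  Valid (s ∷ s' ∷ p) = (proj₁ s ≢ proj₁ s') × Valid (s' ∷ p)

  DCell : Set
  DCell = Σ Path Valid

  𝒯 : DCell
  𝒯 = [] , tt

  -- vertices: the d+1 vertices of 𝒯, and the new vertex of each new d-cell
  data Vtx : Set where
    root : Col → Vtx
    new  : Path → Vtx

  verts : Path → Col → Vtx
  verts [] i = root i
  verts ((j , c) ∷ p) i = if does (i ≟ j) then new ((j , c) ∷ p) else verts p i

  -- a cell of T_{d,k} is a set of vertices of some d-cell; we represent it by
  -- a d-cell together with a subset of its positions
  CellRep : Set
  CellRep = DCell × Subset (suc d)

  _∈V_ : Vtx → CellRep → Set
  v ∈V ((p , _) , S) = ∃ λ s → s ∈ S × verts p s ≡ v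

  _≈C_ : CellRep → CellRep → Set
  σ ≈C ρ = ∀ v → (v ∈V σ) ⇔ (v ∈V ρ)

  -- the cell is a j-cell, where n = j + 1 is its number of vertices
  IsCell : ℕ → CellRep → Set
  IsCell n (_ , S) = ∣ S ∣ ≡ n

  asCell : DCell → CellRep
  asCell τ = τ , full

  _≈D_ : DCell → DCell → Set
  τ ≈D τ' = asCell τ ≈C asCell τ'

  _∈δ_ : DCell → CellRep → Set
  τ ∈δ σ = ∀ v → v ∈V σ → v ∈V asCell τ

  Ck : Set
  Ck = Fin k

  0C : Ck
  0C = 0 mod k

  1C : Ck
  1C = 1 mod k

  _+C_ : Ck → Ck → Ck
  a +C b = (toℕ a + toℕ b) mod k

  record Coloring : Set where
    field
      Γ   : Vtx → Col
      inj : (τ : DCell) (s t : Col) →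
            Γ (verts (proj₁ τ) s) ≡ Γ (verts (proj₁ τ) t) → s ≡ t

  -- k-orderings: to each (d-1)-cell σ a transitive homomorphism
  -- Ω_σ : C_k → Sym(δ(σ))  (δ(σ) considered up to equality of d-cells)
  record KOrdering : Set where
    field
      Ω       : CellRep → Ck → DCell → DCell
      Ω-δ     : ∀ σ → IsCell d σ → ∀ m τ → τ ∈δ σ → Ω σ m τ ∈δ σ
      Ω-respτ : ∀ σ → IsCell d σ → ∀ m τ τ' → τ ∈δ σ → τ ≈D τ' →
                Ω σ m τ ≈D Ω σ m τ'
      Ω-respσ : ∀ σ σ' → IsCell d σ → σ ≈C σ' → ∀ m τ → τ ∈δ σ →
                Ω σ m τ ≈D Ω σ' m τ
      Ω-zero  : ∀ σ → IsCell d σ → ∀ τ → τ ∈δ σ → Ω σ 0C τ ≈D τ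
      Ω-hom   : ∀ σ → IsCell d σ → ∀ m n τ → τ ∈δ σ →
                Ω σ (m +C n) τ ≈D Ω σ m (Ω σ n τ)
      Ω-trans : ∀ σ → IsCell d σ → ∀ τ τ' → τ ∈δ σ → τ' ∈δ σ →
                ∃ λ m → Ω σ m τ ≈D τ'

  -- G_{d,k} = ⟨ α_0,...,α_d | α_i^k = e ⟩ : words in the α_i (α_i^{-1} = α_i^{k-1})
  -- modulo the congruence generated by α_i^k = e.  Product = concatenation.
  Word : Set
  Word = List Col

  infix 4 _≈G_
  data _≈G_ : Word → Word → Set where
    ≈-refl  : ∀ {u} → u ≈G u
    ≈-sym   : ∀ {u v} → u ≈G v → v ≈G u
    ≈-trans : ∀ {u v w} → u ≈G v → v ≈G w → u ≈G w
    ≈-cong  : ∀ {u u' v v'} → u ≈G u' → v ≈G v' → (u ++ v) ≈G (u' ++ v')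
    ≈-rel   : ∀ i → replicate k i ≈G []

  -- h ∈ K_A g  (K_A = ⟨ α_a : a ∈ A ⟩)
  InCoset : Subset (suc d) → Word → Word → Set
  InCoset A g h = ∃ λ w → All (_∈ A) w × h ≈G (w ++ g)

  -- elements of 𝓜^j: right cosets K_{Ĵ} g, represented by (J , g);
  -- equality = equality of the cosets as sets
  MRep : Set
  MRep = Subset (suc d) × Word

  IsM : ℕ → MRep → Set
  IsM n (J , _) = ∣ J ∣ ≡ n

  _≈M_ : MRep → MRep → Set
  (J , g) ≈M (J' , g') = ∀ h → InCoset (∁ J) g h ⇔ InCoset (∁ J') g' h

  module WithData (Γc : Coloring) (Ωk : KOrdering) where
    open Coloring Γc
    open KOrdering Ωk

    ColorIs : CellRep → Subset (suc d) → Set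
    ColorIs ((p , _) , S) J = ∀ c → (c ∈ J) ⇔ (∃ λ s → s ∈ S × Γ (verts p s) ≡ c)

    facetOpp : DCell → Col → CellRep
    facetOpp τ i = τ , tabulate (λ s → not (does (Γ (verts (proj₁ τ) s) ≟ i)))

    act₁ : Col → DCell → DCell
    act₁ i τ = Ω (facetOpp τ i) 1C τ

    act : Word → DCell → DCell
    act [] τ = τ
    act (i ∷ w) τ = act₁ i (act w τ)

    Ψ : MRep → CellRep
    Ψ (J , g) = act g 𝒯 , tabulate (λ s → lookup J (Γ (verts (proj₁ (act g 𝒯)) s)))

-- A d-cell of T_{d,k} is recorded by its attachment path from 𝒯, and each
-- attachment is a rotation α_i^m about the wall of the parent opposite the
-- replaced colour i. Reading these powers off the path gives a normal form with
-- nf(α_i.τ) = α_i·nf(τ) (checked on the wall of τ opposite i, which is a parent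
-- and its k−1 children), so g ↦ g.𝒯 is a bijection from G_{d,k} to d-cells. A
-- generator α_a with a ∉ J turns g.𝒯 about a wall containing its J-face, so
-- K_Ĵ g.𝒯 all share that face; conversely two d-cells with the same J-face both
-- reduce, by peeling attachments of colour outside J, to the same d-cell, which
-- puts them in one K_Ĵ-orbit. Counting a letter mod k separates cosets of
-- different K_Ĵ when k ≥ 2.
module Submission where

open import Defs
open import Data.Nat using (ℕ; suc; _≤_; NonZero)
open import Data.Fin.Subset using (Subset)
open import Data.Product using (_×_; _,_; ∃)

open import Data.Nat using (>-nonZero⁻¹; zero; _+_; _*_; _∸_; _<_; _%_)
import Data.Nat.Properties as ℕ
open import Data.Nat.DivMod
  using (_mod_; _/_; m≡m%n+[m/n]*n; m<n⇒m%n≡m; m%n<n; %-distribˡ-+; n%n≡0; m*n%n≡0)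
open import Data.Fin using (Fin; toℕ; _≟_; punchOut)
import Data.Fin.Properties as Fin
open import Data.Fin.Subset using (_∈_; ∁; ∣_∣; _⊆_)
import Data.Fin.Subset.Properties as Subset
import Data.Fin.Permutation as Perm
open import Data.Vec using (tabulate; lookup)
import Data.Vec.Properties as Vec
open import Data.List using ([]; _∷_; _++_; replicate; length)
import Data.List.Properties as List
open import Data.List.Relation.Unary.All as All using (All; []; _∷_)
import Data.List.Relation.Unary.All.Properties as All
open import Data.List.Relation.Binary.Pointwise using (Pointwise-≡⇒≡; ≡⇒Pointwise-≡)
open import Data.List.Relation.Binary.Suffix.Heterogeneous using (Suffix; here; there)
import Data.List.Relation.Binary.Suffix.Heterogeneous.Properties as Suffix
open import Data.Product using (proj₁; proj₂)
open import Data.Sum using (inj₁; inj₂)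
open import Data.Unit using (⊤; tt)
open import Level using (0ℓ)
open import Data.Bool using (Bool; true; false; not)
import Data.Bool.Properties as Bool
open import Relation.Nullary using (Dec; yes; no; does; contradiction)
import Relation.Nullary.Decidable as Dec
open import Relation.Binary.PropositionalEquality
  using (_≡_; _≢_; refl; sym; trans; cong; cong₂; subst; module ≡-Reasoning)
open import Relation.Binary.Bundles using (Setoid)
open import Function using (_∘_)
open import Function.Bundles using (mk⇔; Equivalence)
import Function.Properties.Equivalence as ⇔
open import Algebra.Properties.CommutativeMonoid.Sum ℕ.+-0-commutativeMonoid using (sum; sum-permute)

injective⇒surjective : ∀ {m n} → n ≤ m → (f : Fin m → Fin n) →
                       (∀ {x y} → f x ≡ f y → x ≡ y) → ∀ y → ∃ λ x → f x ≡ y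
injective⇒surjective {m} {suc n} n≤m f f-inj y with Fin.any? (λ x → f x ≟ y)
... | yes hit = hit
... | no miss = contradiction (Fin.injective⇒≤ g-inj) (ℕ.<⇒≱ n≤m)
  where
  y≢f : ∀ x → y ≢ f x
  y≢f x y≡fx = miss (x , sym y≡fx)
  g : Fin m → Fin n
  g x = punchOut (y≢f x)
  g-inj : ∀ {x x'} → g x ≡ g x' → x ≡ x'
  g-inj {x} {x'} eq = f-inj (Fin.punchOut-injective (y≢f x) (y≢f x') eq)

bool→ℕ : Bool → ℕ
bool→ℕ true = 1
bool→ℕ false = 0

∣tabulate∣≡sum : ∀ {m} (h : Fin m → Bool) → ∣ tabulate h ∣ ≡ sum (bool→ℕ ∘ h)
∣tabulate∣≡sum {zero} h = refl
∣tabulate∣≡sum {suc m} h with h Fin.zero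
... | true = cong suc (∣tabulate∣≡sum (h ∘ Fin.suc))
... | false = ∣tabulate∣≡sum (h ∘ Fin.suc)

∣tabulate∘permutation∣ : ∀ {m} (f g : Fin m → Fin m) → (∀ y → f (g y) ≡ y) → (∀ x → g (f x) ≡ x) →
                         (h : Fin m → Bool) → ∣ tabulate (h ∘ f) ∣ ≡ ∣ tabulate h ∣
∣tabulate∘permutation∣ f g fg gf h = begin
  ∣ tabulate (h ∘ f) ∣   ≡⟨ ∣tabulate∣≡sum (h ∘ f) ⟩
  sum (bool→ℕ ∘ h ∘ f)   ≡⟨ sum-permute (bool→ℕ ∘ h) (Perm.permutation f g fg gf) ⟨
  sum (bool→ℕ ∘ h)       ≡⟨ ∣tabulate∣≡sum h ⟨
  ∣ tabulate h ∣         ∎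
  where open ≡-Reasoning

∣tabulate≢∣ : ∀ {m} (i : Fin (suc m)) → ∣ tabulate (λ c → not (does (c ≟ i))) ∣ ≡ m
∣tabulate≢∣ {m} Fin.zero = ∣tabulate≢0∣ m
  where
  ∣tabulate≢0∣ : ∀ m → ∣ tabulate {n = m} (λ c → not (does (Fin.suc c ≟ Fin.zero))) ∣ ≡ m
  ∣tabulate≢0∣ zero = refl
  ∣tabulate≢0∣ (suc m) = cong suc (∣tabulate≢0∣ m)
∣tabulate≢∣ {suc m} (Fin.suc i) = cong suc (∣tabulate≢∣ i)

∈-tabulate⁺ : ∀ {m} (h : Fin m → Bool) {s} → h s ≡ true → s ∈ tabulate h
∈-tabulate⁺ h {s} hs = Vec.lookup⇒[]= s (tabulate h) (trans (Vec.lookup∘tabulate h s) hs)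

∈-tabulate⁻ : ∀ {m} (h : Fin m → Bool) {s} → s ∈ tabulate h → h s ≡ true
∈-tabulate⁻ h {s} s∈ = trans (sym (Vec.lookup∘tabulate h s)) (Vec.[]=⇒lookup s∈)

∈⇒lookup : ∀ {m} {c : Fin m} {J} → c ∈ J → lookup J c ≡ true
∈⇒lookup = Vec.[]=⇒lookup

lookup⇒∈ : ∀ {m} {c : Fin m} {J} → lookup J c ≡ true → c ∈ J
lookup⇒∈ {c = c} {J} = Vec.lookup⇒[]= c J

∈∁⇒lookup : ∀ {m} {c : Fin m} {J} → c ∈ ∁ J → lookup J c ≡ false
∈∁⇒lookup {c = c} {J} c∈∁J = Bool.not-injective (trans (sym (Vec.lookup-map c not J)) (∈⇒lookup c∈∁J))

lookup⇒∈∁ : ∀ {m} {c : Fin m} {J} → lookup J c ≡ false → c ∈ ∁ J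
lookup⇒∈∁ {c = c} {J} Jc = lookup⇒∈ (trans (Vec.lookup-map c not J) (cong not Jc))

≢⇒not-does : ∀ {m} {c a : Fin m} → c ≢ a → not (does (c ≟ a)) ≡ true
≢⇒not-does {c = c} {a} c≢a with c ≟ a
... | yes c≡a = contradiction c≡a c≢a
... | no _ = refl

not-does⇒≢ : ∀ {m} {c a : Fin m} → not (does (c ≟ a)) ≡ true → c ≢ a
not-does⇒≢ {c = c} {a} ¬c≟a with c ≟ a
... | no c≢a = c≢a

module Complex (d k : ℕ) .{{_ : NonZero k}} where
  open Arboreal d k

  new-injective : ∀ {p q} → new p ≡ new q → p ≡ q
  new-injective refl = refl

  verts-newest : ∀ j c p → verts ((j , c) ∷ p) j ≡ new ((j , c) ∷ p)
  verts-newest j c p with j ≟ j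
  ... | yes _ = refl
  ... | no j≢j = contradiction refl j≢j

  verts-older : ∀ {j s} c p → s ≢ j → verts ((j , c) ∷ p) s ≡ verts p s
  verts-older {j} {s} c p s≢j with s ≟ j
  ... | yes s≡j = contradiction s≡j s≢j
  ... | no _ = refl

  verts≡new⇒suffix : ∀ r s {q} → verts r s ≡ new q → Suffix _≡_ q r
  verts≡new⇒suffix ((j , c) ∷ r) s eq with s ≟ j
  ... | yes _ = here (≡⇒Pointwise-≡ (new-injective (sym eq)))
  ... | no _ = there (verts≡new⇒suffix r s eq)

  []-suffix : ∀ (q : Path) → Suffix _≡_ [] q
  []-suffix [] = here (≡⇒Pointwise-≡ refl)
  []-suffix (_ ∷ q) = there ([]-suffix q)

  path : CellRep → Path
  path ((p , _) , _) = p

  -- σ contains the newest vertex of its d-cell; such a cell determines the d-cell.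
  Anchored : CellRep → Set
  Anchored (([] , _) , _) = ⊤
  Anchored ((((j , _) ∷ _) , _) , S) = j ∈ S

  anchored-suffix : ∀ σ ρ → Anchored σ → (∀ v → v ∈V σ → v ∈V ρ) → Suffix _≡_ (path σ) (path ρ)
  anchored-suffix (([] , _) , _) ρ _ _ = []-suffix (path ρ)
  anchored-suffix ((((j , c) ∷ p) , _) , _) ((q , _) , _) j∈S σ⊆ρ
    with s , _ , eq ← σ⊆ρ _ (j , j∈S , verts-newest j c p) = verts≡new⇒suffix q s eq

  anchored-≈C⇒path≡ : ∀ σ ρ → Anchored σ → Anchored ρ → σ ≈C ρ → path σ ≡ path ρ
  anchored-≈C⇒path≡ σ ρ aσ aρ σ≈ρ = Pointwise-≡⇒≡ (Suffix.antisym (λ e _ → e)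
    (anchored-suffix σ ρ aσ (Equivalence.to ∘ σ≈ρ))
    (anchored-suffix ρ σ aρ (Equivalence.from ∘ σ≈ρ)))

  infix 4 _≅_
  _≅_ : DCell → DCell → Set
  τ ≅ τ' = proj₁ τ ≡ proj₁ τ'

  anchored-asCell : ∀ τ → Anchored (asCell τ)
  anchored-asCell ([] , _) = tt
  anchored-asCell (((j , _) ∷ _) , _) = Subset.∈⊤

  ≈D⇒≅ : ∀ τ τ' → τ ≈D τ' → τ ≅ τ'
  ≈D⇒≅ τ τ' = anchored-≈C⇒path≡ (asCell τ) (asCell τ') (anchored-asCell τ) (anchored-asCell τ')

  ≈C-of-≡ : ∀ {τ τ' : DCell} {S S'} → τ ≅ τ' → S ≡ S' → (τ , S) ≈C (τ' , S')
  ≈C-of-≡ {_ , _} {_ , _} refl refl v = ⇔.refl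

  ≅⇒≈D : ∀ τ τ' → τ ≅ τ' → τ ≈D τ'
  ≅⇒≈D τ τ' τ≅τ' = ≈C-of-≡ {τ} {τ'} τ≅τ' refl

  ≈C-setoid : Setoid 0ℓ 0ℓ
  ≈C-setoid = record
    { Carrier = CellRep
    ; _≈_ = _≈C_
    ; isEquivalence = record
      { refl = λ v → ⇔.refl
      ; sym = λ σ≈ρ v → ⇔.sym (σ≈ρ v)
      ; trans = λ σ≈ρ ρ≈θ v → ⇔.trans (σ≈ρ v) (ρ≈θ v) } }

  ≈G-setoid : Setoid 0ℓ 0ℓ
  ≈G-setoid = record
    { Carrier = Word
    ; _≈_ = _≈G_
    ; isEquivalence = record { refl = ≈-refl ; sym = ≈-sym ; trans = ≈-trans } }

  ≡⇒≈G : ∀ {u v} → u ≡ v → u ≈G v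
  ≡⇒≈G refl = ≈-refl

  ++-congˡ : ∀ u {v v'} → v ≈G v' → u ++ v ≈G u ++ v'
  ++-congˡ u = ≈-cong (≈-refl {u})

  replicate-+ : ∀ a b (i : Col) → replicate (a + b) i ≡ replicate a i ++ replicate b i
  replicate-+ zero b i = refl
  replicate-+ (suc a) b i = cong (i ∷_) (replicate-+ a b i)

  replicate-*k : ∀ q (i : Col) → replicate (q * k) i ≈G []
  replicate-*k zero i = ≈-refl
  replicate-*k (suc q) i = ≈-trans (≡⇒≈G (replicate-+ k (q * k) i)) (≈-cong (≈-rel i) (replicate-*k q i))

  replicate-%k : ∀ n (i : Col) → replicate n i ≈G replicate (n % k) i
  replicate-%k n i = begin
    replicate n i                                    ≡⟨ cong (λ m → replicate m i) (m≡m%n+[m/n]*n n k) ⟩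
    replicate (n % k + n / k * k) i                  ≡⟨ replicate-+ (n % k) (n / k * k) i ⟩
    replicate (n % k) i ++ replicate (n / k * k) i   ≈⟨ ++-congˡ (replicate (n % k) i) (replicate-*k (n / k) i) ⟩
    replicate (n % k) i ++ []                        ≡⟨ List.++-identityʳ _ ⟩
    replicate (n % k) i                              ∎
    where open import Relation.Binary.Reasoning.Setoid ≈G-setoid

  replicate-snoc : ∀ n (i : Col) u → replicate n i ++ i ∷ u ≡ replicate (suc n) i ++ u
  replicate-snoc zero i u = refl
  replicate-snoc (suc n) i u = cong (i ∷_) (replicate-snoc n i u)

  suc[k∸1]≡k : suc (k ∸ 1) ≡ k
  suc[k∸1]≡k = ℕ.m+[n∸m]≡n (>-nonZero⁻¹ k)

  inverse : Word → Word
  inverse [] = []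
  inverse (i ∷ w) = inverse w ++ replicate (k ∸ 1) i

  inverse-++ : ∀ w v → inverse w ++ w ++ v ≈G v
  inverse-++ [] v = ≈-refl
  inverse-++ (i ∷ w) v = begin
    (inverse w ++ replicate (k ∸ 1) i) ++ i ∷ w ++ v  ≡⟨ List.++-assoc (inverse w) _ _ ⟩
    inverse w ++ replicate (k ∸ 1) i ++ i ∷ w ++ v    ≡⟨ cong (inverse w ++_) (replicate-snoc (k ∸ 1) i (w ++ v)) ⟩
    inverse w ++ replicate (suc (k ∸ 1)) i ++ w ++ v  ≡⟨ cong (λ n → inverse w ++ replicate n i ++ w ++ v) suc[k∸1]≡k ⟩
    inverse w ++ replicate k i ++ w ++ v              ≈⟨ ++-congˡ (inverse w) (≈-cong (≈-rel i) ≈-refl) ⟩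
    inverse w ++ w ++ v                               ≈⟨ inverse-++ w v ⟩
    v                                                 ∎
    where open import Relation.Binary.Reasoning.Setoid ≈G-setoid

  All-inverse : ∀ {P : Col → Set} {w} → All P w → All P (inverse w)
  All-inverse [] = []
  All-inverse (pi ∷ pw) = All.++⁺ (All-inverse pw) (All.replicate⁺ (k ∸ 1) pi)

  InCoset-refl : ∀ A g → InCoset A g g
  InCoset-refl A g = [] , [] , ≈-refl

  InCoset-sym : ∀ A {g h} → InCoset A g h → InCoset A h g
  InCoset-sym A {g} {h} (w , w∈A , h≈wg) = inverse w , All-inverse w∈A , (begin
    g                     ≈⟨ inverse-++ w g ⟨
    inverse w ++ w ++ g   ≈⟨ ++-congˡ (inverse w) h≈wg ⟨
    inverse w ++ h        ∎)
    where open import Relation.Binary.Reasoning.Setoid ≈G-setoid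

  InCoset-trans : ∀ A {g h h'} → InCoset A g h → InCoset A h h' → InCoset A g h'
  InCoset-trans A {g} {h} {h'} (w , w∈A , h≈wg) (w' , w'∈A , h'≈w'h) = w' ++ w , All.++⁺ w'∈A w∈A , (begin
    h'              ≈⟨ h'≈w'h ⟩
    w' ++ h         ≈⟨ ++-congˡ w' h≈wg ⟩
    w' ++ w ++ g    ≡⟨ List.++-assoc w' w g ⟨
    (w' ++ w) ++ g  ∎)
    where open import Relation.Binary.Reasoning.Setoid ≈G-setoid

  InCoset-≈G : ∀ A {g g' h h'} → g ≈G g' → h ≈G h' → InCoset A g h → InCoset A g' h'
  InCoset-≈G A g≈g' h≈h' (w , w∈A , h≈wg) =
    w , w∈A , ≈-trans (≈-sym h≈h') (≈-trans h≈wg (++-congˡ w g≈g'))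

  InCoset⇒≈M : ∀ J {g g'} → InCoset (∁ J) g' g → (J , g) ≈M (J , g')
  InCoset⇒≈M J g∈Kg' h = mk⇔ (InCoset-trans (∁ J) g∈Kg') (InCoset-trans (∁ J) (InCoset-sym (∁ J) g∈Kg'))

  count : Col → Word → ℕ
  count a [] = 0
  count a (b ∷ w) = bool→ℕ (does (b ≟ a)) + count a w

  count-++ : ∀ a u v → count a (u ++ v) ≡ count a u + count a v
  count-++ a [] v = refl
  count-++ a (b ∷ u) v = trans (cong (bool→ℕ (does (b ≟ a)) +_) (count-++ a u v)) (sym (ℕ.+-assoc (bool→ℕ (does (b ≟ a))) (count a u) (count a v)))

  count-replicate : ∀ a n i → count a (replicate n i) ≡ n * bool→ℕ (does (i ≟ a))
  count-replicate a zero i = refl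
  count-replicate a (suc n) i = cong (bool→ℕ (does (i ≟ a)) +_) (count-replicate a n i)

  count-∷-self : ∀ a w → count a (a ∷ w) ≡ suc (count a w)
  count-∷-self a w with a ≟ a
  ... | yes _ = refl
  ... | no a≢a = contradiction refl a≢a

  count-avoiding : ∀ a {w} → All (_≢ a) w → count a w ≡ 0
  count-avoiding a [] = refl
  count-avoiding a {b ∷ w} (b≢a ∷ w≢a) with b ≟ a
  ... | yes b≡a = contradiction b≡a b≢a
  ... | no _ = count-avoiding a w≢a

  count-≈G : ∀ a {u v} → u ≈G v → count a u % k ≡ count a v % k
  count-≈G a ≈-refl = refl
  count-≈G a (≈-sym v≈u) = sym (count-≈G a v≈u)
  count-≈G a (≈-trans u≈w w≈v) = trans (count-≈G a u≈w) (count-≈G a w≈v)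
  count-≈G a (≈-cong {u} {u'} {v} {v'} u≈u' v≈v') = begin
    count a (u ++ v) % k                     ≡⟨ cong (_% k) (count-++ a u v) ⟩
    (count a u + count a v) % k              ≡⟨ %-distribˡ-+ (count a u) (count a v) k ⟩
    (count a u % k + count a v % k) % k      ≡⟨ cong₂ (λ x y → (x + y) % k) (count-≈G a u≈u') (count-≈G a v≈v') ⟩
    (count a u' % k + count a v' % k) % k    ≡⟨ %-distribˡ-+ (count a u') (count a v') k ⟨
    (count a u' + count a v') % k            ≡⟨ cong (_% k) (count-++ a u' v') ⟨
    count a (u' ++ v') % k                   ∎
    where open ≡-Reasoning
  count-≈G a (≈-rel i) = begin
    count a (replicate k i) % k              ≡⟨ cong (_% k) (trans (count-replicate a k i) (ℕ.*-comm k _)) ⟩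
    bool→ℕ (does (i ≟ a)) * k % k            ≡⟨ m*n%n≡0 (bool→ℕ (does (i ≟ a))) k ⟩
    0                                        ≡⟨ m<n⇒m%n≡m (>-nonZero⁻¹ k) ⟨
    0 % k                                    ∎
    where open ≡-Reasoning

  count-InCoset : ∀ {a J g h} → a ∈ J → InCoset (∁ J) g h → count a h % k ≡ count a g % k
  count-InCoset {a} {J} {g} {h} a∈J (w , w∈∁J , h≈wg) = begin
    count a h % k                  ≡⟨ count-≈G a h≈wg ⟩
    count a (w ++ g) % k           ≡⟨ cong (_% k) (count-++ a w g) ⟩
    (count a w + count a g) % k    ≡⟨ cong (λ n → (n + count a g) % k) (count-avoiding a (All.map avoids-a w∈∁J)) ⟩
    count a g % k                  ∎
    where
    open ≡-Reasoning
    avoids-a : ∀ {b} → b ∈ ∁ J → b ≢ a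
    avoids-a b∈∁J refl = Subset.x∈∁p⇒x∉p b∈∁J a∈J

  suc%≢% : 2 ≤ k → ∀ x → suc x % k ≢ x % k
  suc%≢% 2≤k x eq = suc-mod-≢ (x % k) (m%n<n x k) (begin
    suc (x % k) % k      ≡⟨ cong (λ y → (y + x % k) % k) (m<n⇒m%n≡m 2≤k) ⟨
    (1 % k + x % k) % k  ≡⟨ %-distribˡ-+ 1 x k ⟨
    suc x % k            ≡⟨ eq ⟩
    x % k                ∎)
    where
    open ≡-Reasoning
    suc-mod-≢ : ∀ r → r < k → suc r % k ≢ r
    suc-mod-≢ r r<k eq′ with ℕ.m≤n⇒m<n∨m≡n r<k
    ... | inj₁ 1+r<k = ℕ.1+n≢n (trans (sym (m<n⇒m%n≡m 1+r<k)) eq′)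
    ... | inj₂ 1+r≡k = ℕ.<-irrefl (sym (trans (sym 1+r≡k) (cong suc r≡0))) 2≤k
      where
      r≡0 : r ≡ 0
      r≡0 = trans (sym eq′) (trans (cong (_% k) 1+r≡k) (n%n≡0 k))

  toℕ-mod : ∀ n → toℕ (n mod k) ≡ n % k
  toℕ-mod n = Fin.toℕ-fromℕ< _

  mod-toℕ : ∀ (a : Ck) → toℕ a mod k ≡ a
  mod-toℕ a = Fin.toℕ-injective (trans (toℕ-mod (toℕ a)) (m<n⇒m%n≡m (Fin.toℕ<n a)))

  toℕ-0C : toℕ 0C ≡ 0
  toℕ-0C = trans (toℕ-mod 0) (m<n⇒m%n≡m (>-nonZero⁻¹ k))

  1C+C-mod : ∀ n → 1C +C (n mod k) ≡ suc n mod k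
  1C+C-mod n = Fin.toℕ-injective (begin
    toℕ (1C +C (n mod k))       ≡⟨ toℕ-mod _ ⟩
    (toℕ 1C + toℕ (n mod k)) % k ≡⟨ cong₂ (λ x y → (x + y) % k) (toℕ-mod 1) (toℕ-mod n) ⟩
    (1 % k + n % k) % k         ≡⟨ %-distribˡ-+ 1 n k ⟨
    suc n % k                   ≡⟨ toℕ-mod (suc n) ⟨
    toℕ (suc n mod k)           ∎)
    where open ≡-Reasoning

  toℕ-1C+C : ∀ a → toℕ (1C +C a) ≡ suc (toℕ a) % k
  toℕ-1C+C a = trans (cong (toℕ ∘ (1C +C_)) (sym (mod-toℕ a))) (trans (cong toℕ (1C+C-mod (toℕ a))) (toℕ-mod _))

  k-mod : k mod k ≡ 0C
  k-mod = Fin.toℕ-injective (trans (toℕ-mod k) (trans (n%n≡0 k) (sym toℕ-0C)))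

module Colored (d k : ℕ) .{{_ : NonZero k}} (Γc : Arboreal.Coloring d k) where
  open Arboreal d k
  open Coloring Γc
  open Complex d k

  col : Path → Col → Col
  col p s = Γ (verts p s)

  col-injective : ∀ τ {s t} → col (proj₁ τ) s ≡ col (proj₁ τ) t → s ≡ t
  col-injective τ {s} {t} = inj τ s t

  col-surjective : ∀ τ c → ∃ λ s → col (proj₁ τ) s ≡ c
  col-surjective τ = injective⇒surjective ℕ.≤-refl (col (proj₁ τ)) (col-injective τ)

  colInv : DCell → Col → Col
  colInv τ c = proj₁ (col-surjective τ c)

  col-colInv : ∀ τ c → col (proj₁ τ) (colInv τ c) ≡ c
  col-colInv τ c = proj₂ (col-surjective τ c)

  colInv-col : ∀ τ s → colInv τ (col (proj₁ τ) s) ≡ s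
  colInv-col τ s = col-injective τ (col-colInv τ (col (proj₁ τ) s))

  same-colour⇒same-vertex : ∀ τ {s t} → col (proj₁ τ) s ≡ col (proj₁ τ) t → verts (proj₁ τ) s ≡ verts (proj₁ τ) t
  same-colour⇒same-vertex τ = cong (verts (proj₁ τ)) ∘ col-injective τ

  Valid-tail : ∀ x p → Valid (x ∷ p) → Valid p
  Valid-tail x [] _ = tt
  Valid-tail x (_ ∷ _) (_ , v) = v

  parent : ∀ x p → Valid (x ∷ p) → DCell
  parent x p v = p , Valid-tail x p v

  col-newest : ∀ j c p (v : Valid ((j , c) ∷ p)) → col ((j , c) ∷ p) j ≡ col p j
  col-newest j c p v = subst (λ s → col ((j , c) ∷ p) s ≡ col p j) s≡j (col-colInv child (col p j))
    where
    child = (j , c) ∷ p , v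
    s = colInv child (col p j)
    s≡j : s ≡ j
    s≡j = Dec.decidable-stable (s ≟ j) λ s≢j → s≢j (col-injective (parent (j , c) p v)
      (trans (sym (cong Γ (verts-older c p s≢j))) (col-colInv child (col p j))))

  -- Ψ (J , g) is definitionally part (lookup J) (act g 𝒯), and facetOpp τ a is facet τ a.
  part : (Col → Bool) → DCell → CellRep
  part P τ = τ , tabulate (P ∘ col (proj₁ τ))

  avoid : Col → Col → Bool
  avoid a c = not (does (c ≟ a))

  facet : DCell → Col → CellRep
  facet τ a = part (avoid a) τ

  ∣part∣ : ∀ P τ → ∣ proj₂ (part P τ) ∣ ≡ ∣ tabulate P ∣
  ∣part∣ P τ = ∣tabulate∘permutation∣ (col (proj₁ τ)) (colInv τ) (col-colInv τ) (colInv-col τ) P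

  facet-isCell : ∀ τ a → IsCell d (facet τ a)
  facet-isCell τ a = trans (∣part∣ (avoid a) τ) (∣tabulate≢∣ a)

  part-≅ : ∀ P τ τ' → τ ≅ τ' → part P τ ≈C part P τ'
  part-≅ P (p , v) (.p , v') refl = ≈C-of-≡ {p , v} {p , v'} refl refl

  self∈δ : ∀ (τ : DCell) S → τ ∈δ (τ , S)
  self∈δ (p , _) S v (s , _ , e) = s , Subset.∈⊤ , e

  child∈δfacet : ∀ j c p (v : Valid ((j , c) ∷ p)) → ((j , c) ∷ p , v) ∈δ facet (parent (j , c) p v) (col p j)
  child∈δfacet j c p v w (s , s∈ , e) =
    s , Subset.∈⊤ , trans (verts-older c p (λ s≡j → s≢ (cong (col p) s≡j))) e
    where
    s≢ : col p s ≢ col p j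
    s≢ = not-does⇒≢ (∈-tabulate⁻ (avoid (col p j) ∘ col p) s∈)

  part-transfer : ∀ P {a} → P a ≡ false → ∀ τ τ' → τ' ∈δ facet τ a → part P τ ≈C part P τ'
  part-transfer P {a} Pa τ τ' τ'∈δ v = mk⇔ to from
    where
    p = proj₁ τ
    p' = proj₁ τ'
    P⇒≢a : ∀ {c} → P c ≡ true → c ≢ a
    P⇒≢a Pc refl = contradiction (trans (sym Pc) Pa) λ ()
    in-facet : ∀ {s} → P (col p s) ≡ true → s ∈ proj₂ (facet τ a)
    in-facet Ps = ∈-tabulate⁺ (avoid a ∘ col p) (≢⇒not-does (P⇒≢a Ps))
    to : v ∈V part P τ → v ∈V part P τ'
    to (s , s∈ , e) =
      let Ps = ∈-tabulate⁻ (P ∘ col p) s∈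
          (u , _ , eu) = τ'∈δ v (s , in-facet Ps , e)
      in u , ∈-tabulate⁺ (P ∘ col p') (trans (cong (P ∘ Γ) (trans eu (sym e))) Ps) , eu
    from : v ∈V part P τ' → v ∈V part P τ
    from (s' , s'∈ , e') =
      let t = colInv τ (col p' s')
          Pt = trans (cong P (col-colInv τ (col p' s'))) (∈-tabulate⁻ (P ∘ col p') s'∈)
          (u , _ , eu) = τ'∈δ (verts p t) (t , in-facet Pt , refl)
          u≡s' = col-injective τ' (trans (cong Γ eu) (col-colInv τ (col p' s')))
      in t , ∈-tabulate⁺ (P ∘ col p) Pt , trans (sym eu) (trans (cong (verts p') u≡s') e')

module Ordered (d k : ℕ) .{{_ : NonZero k}}
               (Γc : Arboreal.Coloring d k) (Ωk : Arboreal.KOrdering d k) where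
  open Arboreal d k
  open WithData Γc Ωk
  open KOrdering Ωk
  open Complex d k
  open Colored d k Γc

  turn : DCell → Col → Ck → DCell
  turn β i m = Ω (facet β i) m β

  ∈δ-≅ : ∀ (τ τ' : DCell) {σ} → τ ≅ τ' → τ ∈δ σ → τ' ∈δ σ
  ∈δ-≅ (p , _) (.p , _) refl τ∈δσ = τ∈δσ

  Ω-cong : ∀ {σ σ' τ τ'} m → IsCell d σ → σ ≈C σ' → τ ≅ τ' → τ ∈δ σ → Ω σ m τ ≅ Ω σ' m τ'
  Ω-cong {σ} {σ'} {τ} {τ'} m σ-cell σ≈σ' τ≅τ' τ∈δσ = trans
    (≈D⇒≅ (Ω σ m τ) (Ω σ m τ') (Ω-respτ σ σ-cell m τ τ' τ∈δσ (≅⇒≈D τ τ' τ≅τ')))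
    (≈D⇒≅ (Ω σ m τ') (Ω σ' m τ') (Ω-respσ σ σ' σ-cell σ≈σ' m τ' (∈δ-≅ τ τ' {σ} τ≅τ' τ∈δσ)))

  turn-≅ : ∀ i m {τ τ'} → τ ≅ τ' → turn τ i m ≅ turn τ' i m
  turn-≅ i m {τ} {τ'} τ≅τ' = Ω-cong m (facet-isCell τ i) (part-≅ (avoid i) τ τ' τ≅τ') τ≅τ' (self∈δ τ _)

  avoid-self : ∀ i → avoid i i ≡ false
  avoid-self i with i ≟ i
  ... | yes _ = refl
  ... | no i≢i = contradiction refl i≢i

  turn-on-wall : ∀ β τ i m → τ ∈δ facet β i → turn τ i m ≅ Ω (facet β i) m τ
  turn-on-wall β τ i m τ∈δ = Ω-cong m (facet-isCell τ i)
    (Setoid.sym ≈C-setoid {facet β i} {facet τ i} (part-transfer (avoid i) (avoid-self i) β τ τ∈δ)) refl (self∈δ τ _)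

  turn-zero : ∀ β i → turn β i 0C ≅ β
  turn-zero β i = ≈D⇒≅ (turn β i 0C) β (Ω-zero (facet β i) (facet-isCell β i) β (self∈δ β _))

  turn∈δ : ∀ β i m → turn β i m ∈δ facet β i
  turn∈δ β i m = Ω-δ (facet β i) (facet-isCell β i) m β (self∈δ β _)

  turn-hom : ∀ β i m n → Ω (facet β i) m (turn β i n) ≅ turn β i (m +C n)
  turn-hom β i m n = sym (≈D⇒≅ (turn β i (m +C n)) (Ω (facet β i) m (turn β i n))
    (Ω-hom (facet β i) (facet-isCell β i) m n β (self∈δ β _)))

  turn-onto : ∀ β i τ → τ ∈δ facet β i → ∃ λ m → turn β i m ≅ τ
  turn-onto β i τ τ∈δ =
    let (m , turn≈τ) = Ω-trans (facet β i) (facet-isCell β i) β τ (self∈δ β _) τ∈δ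
    in m , ≈D⇒≅ (turn β i m) τ turn≈τ

  act₁-turn : ∀ β i a → act₁ i (turn β i a) ≅ turn β i (1C +C a)
  act₁-turn β i a = trans (turn-on-wall β (turn β i a) i 1C (turn∈δ β i a)) (turn-hom β i 1C a)

  act-≅ : ∀ w {τ τ'} → τ ≅ τ' → act w τ ≅ act w τ'
  act-≅ [] τ≅τ' = τ≅τ'
  act-≅ (i ∷ w) τ≅τ' = turn-≅ i 1C (act-≅ w τ≅τ')

  act-++ : ∀ u v τ → act (u ++ v) τ ≡ act u (act v τ)
  act-++ [] v τ = refl
  act-++ (i ∷ u) v τ = cong (act₁ i) (act-++ u v τ)

  act-replicate : ∀ n i τ → act (replicate n i) τ ≅ turn τ i (n mod k)
  act-replicate zero i τ = sym (turn-zero τ i)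
  act-replicate (suc n) i τ = begin
    proj₁ (act₁ i (act (replicate n i) τ))  ≡⟨ turn-≅ i 1C (act-replicate n i τ) ⟩
    proj₁ (act₁ i (turn τ i (n mod k)))     ≡⟨ act₁-turn τ i (n mod k) ⟩
    proj₁ (turn τ i (1C +C (n mod k)))      ≡⟨ cong (proj₁ ∘ turn τ i) (1C+C-mod n) ⟩
    proj₁ (turn τ i (suc n mod k))          ∎
    where open ≡-Reasoning

  act-≈G : ∀ {u v} → u ≈G v → ∀ τ → act u τ ≅ act v τ
  act-≈G ≈-refl τ = refl
  act-≈G (≈-sym v≈u) τ = sym (act-≈G v≈u τ)
  act-≈G (≈-trans u≈w w≈v) τ = trans (act-≈G u≈w τ) (act-≈G w≈v τ)
  act-≈G (≈-cong {u} {u'} {v} {v'} u≈u' v≈v') τ = begin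
    proj₁ (act (u ++ v) τ)     ≡⟨ cong proj₁ (act-++ u v τ) ⟩
    proj₁ (act u (act v τ))    ≡⟨ act-≅ u (act-≈G v≈v' τ) ⟩
    proj₁ (act u (act v' τ))   ≡⟨ act-≈G u≈u' (act v' τ) ⟩
    proj₁ (act u' (act v' τ))  ≡⟨ cong proj₁ (act-++ u' v' τ) ⟨
    proj₁ (act (u' ++ v') τ)   ∎
    where open ≡-Reasoning
  act-≈G (≈-rel i) τ = begin
    proj₁ (act (replicate k i) τ)  ≡⟨ act-replicate k i τ ⟩
    proj₁ (turn τ i (k mod k))     ≡⟨ cong (proj₁ ∘ turn τ i) k-mod ⟩
    proj₁ (turn τ i 0C)            ≡⟨ turn-zero τ i ⟩
    proj₁ τ                        ∎
    where open ≡-Reasoning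

  valid? : ∀ p → Dec (Valid p)
  valid? [] = yes tt
  valid? (_ ∷ []) = yes tt
  valid? ((j , _) ∷ (j' , c') ∷ p) = Dec.¬? (j ≟ j') Dec.×-dec valid? ((j' , c') ∷ p)

  -- Junk value 0C on invalid paths, so that the rotation depends on the path alone
  -- and not on a proof of its validity.
  childTurnOf : ∀ x p → Dec (Valid (x ∷ p)) → Ck
  childTurnOf (j , c) p (yes v) =
    proj₁ (turn-onto (parent (j , c) p v) (col p j) ((j , c) ∷ p , v) (child∈δfacet j c p v))
  childTurnOf _ _ (no _) = 0C

  childTurn : Step → Path → Ck
  childTurn x p = childTurnOf x p (valid? (x ∷ p))

  turn-childTurn : ∀ j c p (v : Valid ((j , c) ∷ p)) →
                   turn (parent (j , c) p v) (col p j) (childTurn (j , c) p) ≅ ((j , c) ∷ p , v)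
  turn-childTurn j c p v = turn-childTurnOf (valid? ((j , c) ∷ p))
    where
    turn-childTurnOf : ∀ dv → turn (parent (j , c) p v) (col p j) (childTurnOf (j , c) p dv) ≅ ((j , c) ∷ p , v)
    turn-childTurnOf (yes v') = trans (turn-≅ (col p j) _ refl)
      (proj₂ (turn-onto (parent (j , c) p v') (col p j) ((j , c) ∷ p , v') (child∈δfacet j c p v')))
    turn-childTurnOf (no ¬v) = contradiction v ¬v

  normalForm : Path → Word
  normalForm [] = []
  normalForm ((j , c) ∷ p) = replicate (toℕ (childTurn (j , c) p)) (col p j) ++ normalForm p

  act-normalForm : ∀ p (v : Valid p) → act (normalForm p) 𝒯 ≅ (p , v)
  act-normalForm [] v = refl
  act-normalForm ((j , c) ∷ p) v = begin
    proj₁ (act (replicate (toℕ m) i ++ normalForm p) 𝒯)      ≡⟨ cong proj₁ (act-++ (replicate (toℕ m) i) (normalForm p) 𝒯) ⟩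
    proj₁ (act (replicate (toℕ m) i) (act (normalForm p) 𝒯)) ≡⟨ act-≅ (replicate (toℕ m) i) (act-normalForm p (proj₂ β)) ⟩
    proj₁ (act (replicate (toℕ m) i) β)                      ≡⟨ act-replicate (toℕ m) i β ⟩
    proj₁ (turn β i (toℕ m mod k))                           ≡⟨ cong (proj₁ ∘ turn β i) (mod-toℕ m) ⟩
    proj₁ (turn β i m)                                       ≡⟨ turn-childTurn j c p v ⟩
    (j , c) ∷ p                                              ∎
    where
    open ≡-Reasoning
    β = parent (j , c) p v
    i = col p j
    m = childTurn (j , c) p

  -- Position s is not that of the newest vertex, so the wall opposite s consists of
  -- the cell and its k−1 children attached at s.
  Outward : Path → Col → Set
  Outward [] s = ⊤
  Outward ((j , _) ∷ _) s = s ≢ j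

  Outward⇒Valid : ∀ p {s} c → Outward p s → Valid p → Valid ((s , c) ∷ p)
  Outward⇒Valid [] c _ _ = tt
  Outward⇒Valid (_ ∷ _) c out v = out , v

  Valid⇒Outward : ∀ x p → Valid (x ∷ p) → Outward p (proj₁ x)
  Valid⇒Outward x [] _ = tt
  Valid⇒Outward x (_ ∷ _) (j≢j' , _) = j≢j'

  normalForm-turn : ∀ β {s i} → Outward (proj₁ β) s → col (proj₁ β) s ≡ i →
                    ∀ m → normalForm (proj₁ (turn β i m)) ≡ replicate (toℕ m) i ++ normalForm (proj₁ β)
  normalForm-turn β {s} out refl m =
    let (x , turnAt[x]≡m) = injective⇒surjective (ℕ.≤-reflexive (sym suc[k∸1]≡k)) turnAt turnAt-injective m
    in begin
      normalForm (proj₁ (turn β i m))           ≡⟨ cong (normalForm ∘ proj₁ ∘ turn β i) turnAt[x]≡m ⟨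
      normalForm (proj₁ (turn β i (turnAt x)))  ≡⟨ cong normalForm (turn-turnAt x) ⟩
      normalForm (proj₁ (cellAt x))             ≡⟨ normalForm-cellAt x ⟩
      replicate (toℕ (turnAt x)) i ++ normalForm p ≡⟨ cong (λ a → replicate (toℕ a) i ++ normalForm p) turnAt[x]≡m ⟩
      replicate (toℕ m) i ++ normalForm p       ∎
    where
    open ≡-Reasoning
    p = proj₁ β
    i = col p s
    cellAt : Fin (suc (k ∸ 1)) → DCell
    cellAt Fin.zero = β
    cellAt (Fin.suc c) = (s , c) ∷ p , Outward⇒Valid p c out (proj₂ β)
    turnAt : Fin (suc (k ∸ 1)) → Ck
    turnAt Fin.zero = 0C
    turnAt (Fin.suc c) = childTurn (s , c) p
    turn-turnAt : ∀ x → turn β i (turnAt x) ≅ cellAt x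
    turn-turnAt Fin.zero = turn-zero β i
    turn-turnAt (Fin.suc c) = trans (turn-≅ i _ refl) (turn-childTurn s c p (Outward⇒Valid p c out (proj₂ β)))
    cellAt-injective : ∀ {x y} → cellAt x ≅ cellAt y → x ≡ y
    cellAt-injective {Fin.zero} {Fin.zero} _ = refl
    cellAt-injective {Fin.zero} {Fin.suc _} p≡c∷p = contradiction (sym (cong length p≡c∷p)) ℕ.1+n≢n
    cellAt-injective {Fin.suc _} {Fin.zero} c∷p≡p = contradiction (cong length c∷p≡p) ℕ.1+n≢n
    cellAt-injective {Fin.suc _} {Fin.suc _} c∷p≡c'∷p = cong (Fin.suc ∘ proj₂) (List.∷-injectiveˡ c∷p≡c'∷p)
    turnAt-injective : ∀ {x y} → turnAt x ≡ turnAt y → x ≡ y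
    turnAt-injective {x} {y} eq =
      cellAt-injective (trans (sym (turn-turnAt x)) (trans (cong (proj₁ ∘ turn β i) eq) (turn-turnAt y)))
    normalForm-cellAt : ∀ x → normalForm (proj₁ (cellAt x)) ≡ replicate (toℕ (turnAt x)) i ++ normalForm p
    normalForm-cellAt Fin.zero = cong (λ n → replicate n i ++ normalForm p) (sym toℕ-0C)
    normalForm-cellAt (Fin.suc c) = refl

  record WallBase (τ : DCell) (i : Col) : Set where
    field
      base : DCell
      position : Col
      outward : Outward (proj₁ base) position
      position-colour : col (proj₁ base) position ≡ i
      rotation : Ck
      τ≅turn : τ ≅ turn base i rotation
      normalForm≡ : normalForm (proj₁ τ) ≡ replicate (toℕ rotation) i ++ normalForm (proj₁ base)

  wallBase-self : ∀ τ i → Outward (proj₁ τ) (colInv τ i) → WallBase τ i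
  wallBase-self τ i out = record
    { base = τ
    ; position = colInv τ i
    ; outward = out
    ; position-colour = col-colInv τ i
    ; rotation = 0C
    ; τ≅turn = sym (turn-zero τ i)
    ; normalForm≡ = cong (λ n → replicate n i ++ normalForm (proj₁ τ)) (sym toℕ-0C) }

  wallBase-parent : ∀ j c p (v : Valid ((j , c) ∷ p)) → WallBase ((j , c) ∷ p , v) (col p j)
  wallBase-parent j c p v = record
    { base = parent (j , c) p v
    ; position = j
    ; outward = Valid⇒Outward (j , c) p v
    ; position-colour = refl
    ; rotation = childTurn (j , c) p
    ; τ≅turn = sym (turn-childTurn j c p v)
    ; normalForm≡ = refl }

  -- The base is τ itself, unless the newest vertex of τ has colour i: then τ was
  -- attached along this very wall and the base is its parent.
  wallBase : ∀ τ i → WallBase τ i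
  wallBase ([] , v) i = wallBase-self ([] , v) i tt
  wallBase τ@((j , c) ∷ p , v) i with colInv τ i ≟ j
  ... | no s≢j = wallBase-self τ i s≢j
  ... | yes s≡j = subst (WallBase τ) (begin
    col p j                    ≡⟨ col-newest j c p v ⟨
    col ((j , c) ∷ p) j        ≡⟨ cong (col ((j , c) ∷ p)) s≡j ⟨
    col ((j , c) ∷ p) (colInv τ i) ≡⟨ col-colInv τ i ⟩
    i                          ∎) (wallBase-parent j c p v)
    where open ≡-Reasoning

  normalForm-act₁ : ∀ i τ → normalForm (proj₁ (act₁ i τ)) ≈G i ∷ normalForm (proj₁ τ)
  normalForm-act₁ i τ = begin
    normalForm (proj₁ (act₁ i τ))                       ≡⟨ cong normalForm act₁τ≅ ⟩
    normalForm (proj₁ (turn base i (1C +C rotation)))   ≡⟨ normalForm-turn base outward position-colour _ ⟩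
    replicate (toℕ (1C +C rotation)) i ++ nf-base       ≡⟨ cong (λ n → replicate n i ++ nf-base) (toℕ-1C+C rotation) ⟩
    replicate (suc (toℕ rotation) % k) i ++ nf-base     ≈⟨ ≈-cong (replicate-%k (suc (toℕ rotation)) i) ≈-refl ⟨
    i ∷ replicate (toℕ rotation) i ++ nf-base           ≡⟨ cong (i ∷_) normalForm≡ ⟨
    i ∷ normalForm (proj₁ τ)                            ∎
    where
    open WallBase (wallBase τ i)
    open import Relation.Binary.Reasoning.Setoid ≈G-setoid
    nf-base = normalForm (proj₁ base)
    act₁τ≅ : act₁ i τ ≅ turn base i (1C +C rotation)
    act₁τ≅ = trans (turn-≅ i 1C τ≅turn) (act₁-turn base i rotation)

  normalForm-act : ∀ w → normalForm (proj₁ (act w 𝒯)) ≈G w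
  normalForm-act [] = ≈-refl
  normalForm-act (i ∷ w) = ≈-trans (normalForm-act₁ i (act w 𝒯)) (++-congˡ (i ∷ []) (normalForm-act w))

  part-act : ∀ P w τ → All (λ a → P a ≡ false) w → part P (act w τ) ≈C part P τ
  part-act P [] τ _ = Setoid.refl ≈C-setoid {part P τ}
  part-act P (a ∷ w) τ (Pa ∷ Pw) = begin
    part P (act₁ a (act w τ))  ≈⟨ part-transfer P Pa (act w τ) (act₁ a (act w τ)) (turn∈δ (act w τ) a 1C) ⟨
    part P (act w τ)           ≈⟨ part-act P w τ Pw ⟩
    part P τ                   ∎
    where open import Relation.Binary.Reasoning.Setoid ≈C-setoid

  Reduced : Subset (suc d) → Path → Set
  Reduced J [] = ⊤
  Reduced J ((j , _) ∷ p) = lookup J (col p j) ≡ true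

  reduced-anchored : ∀ J p (v : Valid p) → Reduced J p → Anchored (part (lookup J) (p , v))
  reduced-anchored J [] v _ = tt
  reduced-anchored J ((j , c) ∷ p) v Jj =
    ∈-tabulate⁺ (lookup J ∘ col ((j , c) ∷ p)) (trans (cong (lookup J) (col-newest j c p v)) Jj)

  record Reduction (J : Subset (suc d)) (τ : DCell) : Set where
    field
      reduct : DCell
      reduced : Reduced J (proj₁ reduct)
      same-part : part (lookup J) reduct ≈C part (lookup J) τ
      coset : InCoset (∁ J) (normalForm (proj₁ reduct)) (normalForm (proj₁ τ))

  -- Drop the newest vertex while its colour lies outside J: the cell lies on its
  -- parent's wall of that colour, so the J-part and the K_Ĵ-coset are unchanged.
  reduction : ∀ J p (v : Valid p) → Reduction J (p , v)
  reduction J [] v = record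
    { reduct = [] , v ; reduced = tt ; same-part = Setoid.refl ≈C-setoid {part (lookup J) ([] , v)}
    ; coset = InCoset-refl (∁ J) [] }
  reduction J ((j , c) ∷ p) v with lookup J (col p j) in Jj
  ... | true = record
    { reduct = τ ; reduced = Jj ; same-part = Setoid.refl ≈C-setoid {part (lookup J) τ}
    ; coset = InCoset-refl (∁ J) (normalForm ((j , c) ∷ p)) }
    where τ = (j , c) ∷ p , v
  ... | false = record
    { reduct = reduct
    ; reduced = reduced
    ; same-part = begin
        part (lookup J) reduct  ≈⟨ same-part ⟩
        part (lookup J) β       ≈⟨ part-transfer (lookup J) Jj β τ (child∈δfacet j c p v) ⟩
        part (lookup J) τ       ∎
    ; coset = InCoset-trans (∁ J) coset
        (replicate (toℕ (childTurn (j , c) p)) (col p j) , All.replicate⁺ _ (lookup⇒∈∁ Jj) , ≈-refl) }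
    where
    open Reduction (reduction J p (Valid-tail (j , c) p v))
    open import Relation.Binary.Reasoning.Setoid ≈C-setoid
    τ = (j , c) ∷ p , v
    β = parent (j , c) p v

  same-part⇒InCoset : ∀ J τ τ' → part (lookup J) τ ≈C part (lookup J) τ' →
                      InCoset (∁ J) (normalForm (proj₁ τ')) (normalForm (proj₁ τ))
  same-part⇒InCoset J (p , v) (p' , v') τ≈τ' = InCoset-trans (∁ J) (InCoset-sym (∁ J) R'.coset)
    (subst (λ q → InCoset (∁ J) (normalForm q) (normalForm p)) reducts≡ R.coset)
    where
    module R = Reduction (reduction J p v)
    module R' = Reduction (reduction J p' v')
    open import Relation.Binary.Reasoning.Setoid ≈C-setoid
    reducts≡ : proj₁ R.reduct ≡ proj₁ R'.reduct
    reducts≡ = anchored-≈C⇒path≡ (part (lookup J) R.reduct) (part (lookup J) R'.reduct)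
      (reduced-anchored J _ (proj₂ R.reduct) R.reduced) (reduced-anchored J _ (proj₂ R'.reduct) R'.reduced)
      (begin
        part (lookup J) R.reduct   ≈⟨ R.same-part ⟩
        part (lookup J) (p , v)    ≈⟨ τ≈τ' ⟩
        part (lookup J) (p' , v')  ≈⟨ R'.same-part ⟨
        part (lookup J) R'.reduct  ∎)

  part-colour : ∀ J τ → ColorIs (part (lookup J) τ) J
  part-colour J τ c = mk⇔
    (λ c∈J → colInv τ c , ∈-tabulate⁺ (lookup J ∘ col (proj₁ τ))
      (trans (cong (lookup J) (col-colInv τ c)) (∈⇒lookup c∈J)) , col-colInv τ c)
    (λ (s , s∈ , e) → lookup⇒∈ (trans (cong (lookup J) (sym e)) (∈-tabulate⁻ (lookup J ∘ col (proj₁ τ)) s∈)))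

  colour-unique : ∀ J τ S → ColorIs (τ , S) J → (τ , S) ≈C part (lookup J) τ
  colour-unique J τ S colourJ v = mk⇔
    (λ (s , s∈S , e) → s , ∈-tabulate⁺ (lookup J ∘ col p) (∈⇒lookup (Equivalence.from (colourJ (col p s)) (s , s∈S , refl))) , e)
    (λ (s , s∈ , e) →
      let (s' , s'∈S , e') = Equivalence.to (colourJ (col p s)) (lookup⇒∈ (∈-tabulate⁻ (lookup J ∘ col p) s∈))
      in s' , s'∈S , trans (same-colour⇒same-vertex τ e') e)
    where p = proj₁ τ

  colours-⊆ : ∀ σ ρ {J J'} → ColorIs σ J → ColorIs ρ J' → (∀ v → v ∈V σ → v ∈V ρ) → J ⊆ J'
  colours-⊆ ((p , _) , _) ((p' , _) , _) colourJ colourJ' σ⊆ρ {c} c∈J =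
    let (s , s∈ , e) = Equivalence.to (colourJ c) c∈J
        (u , u∈ , eu) = σ⊆ρ (verts p s) (s , s∈ , refl)
    in Equivalence.from (colourJ' c) (u , u∈ , trans (cong Γ eu) e)
    where open Coloring Γc

  ∣part-lookup∣ : ∀ J τ → ∣ proj₂ (part (lookup J) τ) ∣ ≡ ∣ J ∣
  ∣part-lookup∣ J τ = trans (∣part∣ (lookup J) τ) (cong ∣_∣ (Vec.tabulate∘lookup J))

  -- If a ∈ J' ∖ J, then both g and α_a g lie in K_Ĵ' g', yet they differ in the
  -- number of letters a mod k.
  coset-⊆ : 2 ≤ k → ∀ J g J' g' → (∀ h → InCoset (∁ J) g h → InCoset (∁ J') g' h) → J' ⊆ J
  coset-⊆ 2≤k J g J' g' K⊆K' {a} a∈J' = Dec.decidable-stable (a Subset.∈? J) λ a∉J →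
    suc%≢% 2≤k (count a g) (begin
      suc (count a g) % k  ≡⟨ cong (_% k) (count-∷-self a g) ⟨
      count a (a ∷ g) % k  ≡⟨ count-InCoset a∈J' (K⊆K' (a ∷ g) (a ∷ [] , Subset.x∉p⇒x∈∁p a∉J ∷ [] , ≈-refl)) ⟩
      count a g' % k       ≡⟨ count-InCoset a∈J' (K⊆K' g (InCoset-refl (∁ J) g)) ⟨
      count a g % k        ∎)
    where open ≡-Reasoning

  Ψ-wellDefined : 2 ≤ k → ∀ x y → x ≈M y → Ψ x ≈C Ψ y
  Ψ-wellDefined 2≤k (J , g) (J' , g') x≈y
    with refl ← Subset.⊆-antisym (coset-⊆ 2≤k J' g' J g (Equivalence.from ∘ x≈y))
                                 (coset-⊆ 2≤k J g J' g' (Equivalence.to ∘ x≈y))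
    with w , w∈∁J , g'≈wg ← Equivalence.from (x≈y g') (InCoset-refl (∁ J) g') = begin
      part (lookup J) (act g 𝒯)           ≈⟨ part-act (lookup J) w (act g 𝒯) (All.map ∈∁⇒lookup w∈∁J) ⟨
      part (lookup J) (act w (act g 𝒯))   ≈⟨ part-≅ (lookup J) (act w (act g 𝒯)) (act g' 𝒯) act-w-g≅ ⟩
      part (lookup J) (act g' 𝒯)          ∎
    where
    open import Relation.Binary.Reasoning.Setoid ≈C-setoid
    act-w-g≅ : act w (act g 𝒯) ≅ act g' 𝒯
    act-w-g≅ = trans (cong proj₁ (sym (act-++ w g 𝒯))) (act-≈G (≈-sym g'≈wg) 𝒯)

  Ψ-injective : ∀ x y → Ψ x ≈C Ψ y → x ≈M y
  Ψ-injective (J , g) (J' , g') Ψx≈Ψy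
    with refl ← Subset.⊆-antisym
      (colours-⊆ (Ψ (J , g)) (Ψ (J' , g')) (part-colour J (act g 𝒯)) (part-colour J' (act g' 𝒯)) (Equivalence.to ∘ Ψx≈Ψy))
      (colours-⊆ (Ψ (J' , g')) (Ψ (J , g)) (part-colour J' (act g' 𝒯)) (part-colour J (act g 𝒯)) (Equivalence.from ∘ Ψx≈Ψy))
    = InCoset⇒≈M J (InCoset-≈G (∁ J) (normalForm-act g') (normalForm-act g)
                                       (same-part⇒InCoset J (act g 𝒯) (act g' 𝒯) Ψx≈Ψy))

  Ψ-surjective : ∀ n ρ → IsCell n ρ → ∃ λ x → IsM n x × Ψ x ≈C ρ
  Ψ-surjective n ((p , v) , S) ∣S∣≡n = (J , normalForm p) , ∣J∣≡n , (begin
    part (lookup J) (act (normalForm p) 𝒯)  ≈⟨ part-≅ (lookup J) (act (normalForm p) 𝒯) τ (act-normalForm p v) ⟩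
    part (lookup J) τ                       ≈⟨ ≈C-of-≡ {τ} {τ} refl partJ≡S ⟩
    (τ , S)                                 ∎)
    where
    open import Relation.Binary.Reasoning.Setoid ≈C-setoid
    τ = p , v
    J = tabulate (lookup S ∘ colInv τ)
    ∣J∣≡n : ∣ J ∣ ≡ n
    ∣J∣≡n = trans (∣tabulate∘permutation∣ (colInv τ) (col p) (colInv-col τ) (col-colInv τ) (lookup S))
                  (trans (cong ∣_∣ (Vec.tabulate∘lookup S)) ∣S∣≡n)
    partJ≡S : tabulate (lookup J ∘ col p) ≡ S
    partJ≡S = trans (Vec.tabulate-cong λ s → trans (Vec.lookup∘tabulate (lookup S ∘ colInv τ) (col p s))
                                                    (cong (lookup S) (colInv-col τ s)))
                    (Vec.tabulate∘lookup S)

corollary5p13 : (d k : ℕ) .{{_ : NonZero k}} → 2 ≤ k →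
    (Γc : Arboreal.Coloring d k) (Ωk : Arboreal.KOrdering d k) →
    (n : ℕ) → n ≤ suc d →
    let open Arboreal d k
        open WithData Γc Ωk
    in
    -- Ψ(K_Ĵ g) is the unique cell of g.𝒯 whose color is J, and it is a j-cell
    (∀ (J : Subset (suc d)) (g : Word) → IsM n (J , g) →
       IsCell n (Ψ (J , g)) × ColorIs (Ψ (J , g)) J ×
       (∀ (S : Subset (suc d)) → ColorIs (act g 𝒯 , S) J → (act g 𝒯 , S) ≈C Ψ (J , g)))
    -- well-defined (independent of the representative of the coset)
    × (∀ (x y : MRep) → IsM n x → IsM n y → x ≈M y → Ψ x ≈C Ψ y)
    -- injective
    × (∀ (x y : MRep) → IsM n x → IsM n y → Ψ x ≈C Ψ y → x ≈M y)
    -- surjective onto T^j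
    × (∀ (ρ : CellRep) → IsCell n ρ → ∃ λ x → IsM n x × Ψ x ≈C ρ)
corollary5p13 d k 2≤k Γc Ωk n _ =
    (λ J g ∣J∣≡n → trans (∣part-lookup∣ J (act g 𝒯)) ∣J∣≡n
                 , part-colour J (act g 𝒯)
                 , λ S → colour-unique J (act g 𝒯) S)
  , (λ x y _ _ → Ψ-wellDefined 2≤k x y)
  , (λ x y _ _ → Ψ-injective x y)
  , Ψ-surjective n
  where
  open Arboreal d k
  open WithData Γc Ωk
  open Ordered d k Γc Ωk
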